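{- The class of P-rankable sets is not closed under join; that is, there exist P-rankable sets $A, B\subseteq\Sigma^*$ such that $A\oplus B$ is not P-rankable.
   Context: $\Sigma=\{0,1\}$; strings are ordered in length-lexicographic order, and natural numbers are identified with strings in the standard way. For $A\subseteq\Sigma^*$, $\mathrm{rank}_A(y)=\|\{z\mid z\le y \wedge z\in A\}\|$. A (possibly partial) function $f$ is a ranking function for $A$ if $\mathrm{domain}(f)\supseteq A$ and $f(x)=\mathrm{rank}_A(x)$ for all $x\in A$ (no requirement for $x\notin A$); $A$ is P-rankable if it has a ranking function that is a total polynomial-time computable function. The join is $A\oplus B=\{x0\mid x\in A\}\cup\{x1\mid x\in B\}$. -}

module Defs where

open import Data.Bool using (Bool; true; false)
open import Data.Nat using (ℕ; zero; suc; _+_; _*_; _∸_; _^_; _≤_; _<_)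
open import Data.Fin using (Fin)
open import Data.List using (List; []; _∷_; length; _++_; [_]; foldl)
open import Data.List.Membership.Propositional using (_∈_)
open import Data.List.Relation.Unary.Unique.Propositional using (Unique)
open import Data.Maybe using (Maybe; just; nothing)
open import Data.Product using (Σ; _×_; _,_)
open import Data.Sum using (_⊎_)
open import Data.Unit using (⊤)
open import Data.Empty using (⊥)
open import Function.Bundles using (_⇔_)
open import Relation.Binary.PropositionalEquality using (_≡_)
open import Relation.Nullary using (¬_)

-- Strings over Σ = {0,1}: false = 0, true = 1.

Str : Set
Str = List Bool

Lang : Set₁
Lang = Str → Set

lexLe : Str → Str → Set
lexLe []       _        = ⊤
lexLe (_ ∷ _)  []       = ⊥
lexLe (a ∷ as) (b ∷ bs) = (a ≡ false × b ≡ true) ⊎ (a ≡ b × lexLe as bs)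

_≤ll_ : Str → Str → Set
z ≤ll y = length z < length y ⊎ (length z ≡ length y × lexLe z y)

-- Standard identification of natural numbers with strings:
-- ε ↦ 0, 0 ↦ 1, 1 ↦ 2, 00 ↦ 3, ...  i.e. x ↦ (value of binary 1x) − 1.

binVal : Str → ℕ
binVal = foldl (λ acc b → 2 * acc + bit b) 0
  where
  bit : Bool → ℕ
  bit true  = 1
  bit false = 0

strToℕ : Str → ℕ
strToℕ x = binVal (true ∷ x) ∸ 1

-- rank_A(y) = n : the number of z ≤ y with z ∈ A is n.
-- (Stated relationally, so A may be an arbitrary predicate.)

RankIs : Lang → Str → ℕ → Set
RankIs A y n =
  Σ (List Str) λ l →
    Unique l × (∀ z → (z ∈ l ⇔ (z ≤ll y × A z))) × length l ≡ n

IsRankingFn : Lang → (Str → Str) → Set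
IsRankingFn A f = ∀ x → A x → RankIs A x (strToℕ (f x))

-- Deterministic single-tape Turing machines (two-way infinite tape).
-- Tape alphabet: Fin (3 + extra) where 0 = blank, 1 = symbol '0',
-- 2 = symbol '1', others are auxiliary work symbols.

data Move : Set where
  L R S : Move

record TM : Set where
  field
    nStates : ℕ
    extra   : ℕ
    start   : Fin (suc nStates)
    -- nothing = halt
    δ : Fin (suc nStates) → Fin (3 + extra)
        → Maybe (Fin (suc nStates) × Fin (3 + extra) × Move)

module _ (M : TM) where
  open TM M

  Sym : Set
  Sym = Fin (3 + extra)

  blank : Sym
  blank = Fin.zero
    where import Data.Fin as Fin

  enc : Bool → Sym
  enc false = Fin.suc Fin.zero   where import Data.Fin as Fin
  enc true  = Fin.suc (Fin.suc Fin.zero) where import Data.Fin as Fin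

  -- configuration: state, reversed left part, head symbol, right part
  record Config : Set where
    constructor cfg
    field
      state : Fin (suc nStates)
      left  : List Sym
      head  : Sym
      right : List Sym

  initCfg : Str → Config
  initCfg []       = cfg start [] blank []
  initCfg (b ∷ bs) = cfg start [] (enc b) (Data.List.map enc bs)
    where import Data.List

  move : Move → List Sym → Sym → List Sym → Config → Config
  move S l h r c = record c { left = l ; head = h ; right = r }
  move L []      h r c = record c { left = [] ; head = blank ; right = h ∷ r }
  move L (x ∷ l) h r c = record c { left = l ; head = x ; right = h ∷ r }
  move R l h []      c = record c { left = h ∷ l ; head = blank ; right = [] }
  move R l h (x ∷ r) c = record c { left = h ∷ l ; head = x ; right = r }

  step : Config → Maybe Config
  step c with δ (Config.state c) (Config.head c)
  ... | nothing = nothing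
  ... | just (q , s , m) =
        just (move m (Config.left c) s (Config.right c)
                (record c { state = q }))

  Halted : Config → Set
  Halted c = step c ≡ nothing

  run : ℕ → Config → Config
  run zero    c = c
  run (suc t) c with step c
  ... | nothing = c
  ... | just c' = run t c'

  decode : List Sym → Str
  decode [] = []
  decode (s ∷ ss) with Data.Fin.toℕ s
    where import Data.Fin
  ... | 1 = false ∷ decode ss
  ... | 2 = true  ∷ decode ss
  ... | _ = []

  output : Config → Str
  output c = decode (Config.head c ∷ Config.right c)

ComputesWithin : TM → (ℕ → ℕ) → (Str → Str) → Set
ComputesWithin M T f =
  ∀ x → Σ ℕ λ t → t ≤ T (length x)
        × Halted M (run M t (initCfg M x))
        × output M (run M t (initCfg M x)) ≡ f x

PolyTime : (Str → Str) → Set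
PolyTime f = Σ TM λ M → Σ ℕ λ c → Σ ℕ λ k →
  ComputesWithin M (λ n → c * n ^ k + c) f

PRankable : Lang → Set
PRankable A = Σ (Str → Str) λ f → PolyTime f × IsRankingFn A f

_⊕_ : Lang → Lang → Lang
(A ⊕ B) w = (Σ Str λ x → w ≡ x ++ [ false ] × A x)
          ⊎ (Σ Str λ x → w ≡ x ++ [ true ] × B x)

-- For c : ℕ → Bool let Tagged c = { c(|y|) y | y ≠ ε }. Every nonempty y has exactly
-- one tagged extension, so the rank of c(|y|) y in Tagged c is the number of nonempty
-- strings up to y, i.e. strToℕ y, whatever c is: deleting the first letter is a
-- polynomial-time ranking function of every Tagged c, computable or not.
-- Take A = Tagged c and B = Tagged (const 0), and let n = strToℕ 0ʲ⁺¹. The rank of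
-- 0 0ʲ⁺¹ 1 in A ⊕ B is rank_A (0 0ʲ⁺¹) + rank_B (0 0ʲ⁺¹), which is n + n if c (j + 1) = 0
-- and (n − 1) + n if c (j + 1) = 1. Enumerate all clock-bounded Turing machines and let
-- c (j + 1) = 1 exactly when the j-th of them outputs n + n on 0 0ʲ⁺¹ 1; then no
-- polynomial-time function ranks A ⊕ B.
module Submission where

open import Data.Bool using (Bool; true; false)
open import Data.Empty using (⊥; ⊥-elim)
open import Data.Fin as Fin using (Fin)
open import Data.Fin.Properties using (toℕ-fromℕ<; toℕ<n) renaming (toℕ-injective to toℕ-injectiveᶠ)
open import Data.List
  using (List; []; _∷_; length; _++_; [_]; _∷ʳ_; map; foldl; reverse; replicate; applyUpTo; drop; allFin; cartesianProduct)
open import Data.List.Properties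
  using (foldl-cong; foldl-++; unfold-reverse; reverse-involutive; ∷ʳ-injectiveˡ; ∷ʳ-injectiveʳ; ∷-injectiveʳ; map-cong; length-map; length-++; length-applyUpTo; length-replicate)
open import Data.List.Membership.Propositional using (_∈_)
open import Data.List.Membership.Propositional.Properties
  using (∈-map⁺; ∈-map⁻; ∈-++⁺ˡ; ∈-++⁺ʳ; ∈-++⁻; ∈-applyUpTo⁺; ∈-applyUpTo⁻; ∈-allFin; ∈-cartesianProduct⁺)
open import Data.List.Membership.Propositional.Properties.WithK using (unique∧set⇒bag)
open import Data.List.Relation.Binary.BagAndSetEquality using (∼bag⇒↭)
open import Data.List.Relation.Binary.Permutation.Propositional.Properties using (↭-length)
open import Data.List.Relation.Unary.Any using (here; there)
open import Data.List.Relation.Unary.Unique.Propositional using (Unique)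
import Data.List.Relation.Unary.Unique.Propositional.Properties as Unique
open import Data.Maybe as Maybe using (Maybe; just; nothing)
open import Data.Nat
open import Data.Nat.Binary.Base as ℕᵇ using (ℕᵇ; 2[1+_]; 1+[2_])
import Data.Nat.Binary.Properties as ℕᵇ
open import Data.Nat.DivMod using (_mod_; m<n⇒m%n≡m)
open import Data.Nat.Properties
open import Data.Nat.Tactic.RingSolver using (solve-∀)
open import Data.Product using (Σ; _×_; _,_; proj₁; proj₂)
open import Data.Sum using (inj₁; inj₂)
open import Data.Unit using (tt)
open import Function using (_∘_)
open import Function.Bundles using (_⇔_; mk⇔; Equivalence)
open import Relation.Binary.Definitions using (tri<; tri≈; tri>)
open import Relation.Binary.PropositionalEquality hiding ([_])
open import Relation.Nullary using (¬_; yes; no; does)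

open import Defs

open Equivalence using (to; from)

-- Strings as numbers

bit : Bool → ℕ
bit false = 0
bit true  = 1

bit≤1 : ∀ b → bit b ≤ 1
bit≤1 false = z≤n
bit≤1 true  = s≤s z≤n

push : ℕ → Bool → ℕ
push acc b = 2 * acc + bit b

value : Str → ℕ
value = foldl push 0

-- Defs computes binVal with a digit function local to a where-block, so value restates it.
binVal≡value : ∀ x → binVal x ≡ value x
binVal≡value = foldl-cong (λ { _ false → refl ; _ true → refl }) 0

foldl-push : ∀ a x → foldl push a x ≡ a * 2 ^ length x + value x
foldl-push a []      = sym (trans (+-identityʳ _) (*-identityʳ a))
foldl-push a (b ∷ x) = begin
  foldl push (push a b) x                    ≡⟨ foldl-push (push a b) x ⟩
  (2 * a + bit b) * 2 ^ length x + value x   ≡⟨ shift a (bit b) (2 ^ length x) (value x) ⟩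
  a * (2 * 2 ^ length x) + (bit b * 2 ^ length x + value x)
                                             ≡⟨ cong (a * 2 ^ suc (length x) +_) (foldl-push (bit b) x) ⟨
  a * 2 ^ suc (length x) + foldl push (bit b) x ∎
  where
  open ≡-Reasoning
  shift : ∀ a c p v → (2 * a + c) * p + v ≡ a * (2 * p) + (c * p + v)
  shift = solve-∀

value-∷ : ∀ b x → value (b ∷ x) ≡ bit b * 2 ^ length x + value x
value-∷ b x = foldl-push (bit b) x

value-∷ʳ : ∀ x b → value (x ∷ʳ b) ≡ 2 * value x + bit b
value-∷ʳ x b = foldl-++ push 0 x [ b ]

value<2^length : ∀ x → value x < 2 ^ length x
value<2^length []      = s≤s z≤n
value<2^length (b ∷ x) = begin-strict
  value (b ∷ x)           ≡⟨ value-∷ b x ⟩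
  bit b * p + value x     <⟨ +-monoʳ-< (bit b * p) (value<2^length x) ⟩
  bit b * p + p           ≤⟨ +-monoˡ-≤ p (≤-trans (*-monoˡ-≤ p (bit≤1 b)) (≤-reflexive (*-identityˡ p))) ⟩
  p + p                   ≡⟨ cong (p +_) (+-identityʳ p) ⟨
  2 * p                   ∎
  where
  open ≤-Reasoning
  p = 2 ^ length x

value-true∷ : ∀ x → value (true ∷ x) ≡ 2 ^ length x + value x
value-true∷ x = trans (value-∷ true x) (cong (_+ value x) (*-identityˡ _))

suc-strToℕ≡value : ∀ x → suc (strToℕ x) ≡ value (true ∷ x)
suc-strToℕ≡value x rewrite binVal≡value (true ∷ x) =
  trans (+-comm 1 _) (m∸n+n≡m (subst (1 ≤_) (sym (value-true∷ x))
    (≤-trans (m^n>0 2 (length x)) (m≤m+n _ _))))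

suc-strToℕ : ∀ x → suc (strToℕ x) ≡ 2 ^ length x + value x
suc-strToℕ x = trans (suc-strToℕ≡value x) (value-true∷ x)

strToℕ-∷ʳ : ∀ x b → strToℕ (x ∷ʳ b) ≡ 2 * strToℕ x + 1 + bit b
strToℕ-∷ʳ x b = suc-injective (begin
  suc (strToℕ (x ∷ʳ b))                 ≡⟨ suc-strToℕ≡value (x ∷ʳ b) ⟩
  value (true ∷ x ∷ʳ b)                 ≡⟨ value-∷ʳ (true ∷ x) b ⟩
  2 * value (true ∷ x) + bit b          ≡⟨ cong (λ v → 2 * v + bit b) (sym (suc-strToℕ≡value x)) ⟩
  2 * suc (strToℕ x) + bit b            ≡⟨ double-suc (strToℕ x) (bit b) ⟩
  suc (2 * strToℕ x + 1 + bit b)        ∎)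
  where
  open ≡-Reasoning
  double-suc : ∀ s c → 2 * suc s + c ≡ suc (2 * s + 1 + c)
  double-suc = solve-∀

-- Read from its last letter, a string is the bijective base-2 numeral of
-- strToℕ with digits 1 (for 0) and 2 (for 1); these are exactly the
-- constructors 1+[2_] and 2[1+_] of ℕᵇ.
reversedToℕᵇ : Str → ℕᵇ
reversedToℕᵇ []          = ℕᵇ.zero
reversedToℕᵇ (false ∷ r) = 1+[2 reversedToℕᵇ r ]
reversedToℕᵇ (true ∷ r)  = 2[1+ reversedToℕᵇ r ]

ℕᵇToReversed : ℕᵇ → Str
ℕᵇToReversed ℕᵇ.zero = []
ℕᵇToReversed 1+[2 n ] = false ∷ ℕᵇToReversed n
ℕᵇToReversed 2[1+ n ] = true ∷ ℕᵇToReversed n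

ℕᵇToReversed-reversedToℕᵇ : ∀ r → ℕᵇToReversed (reversedToℕᵇ r) ≡ r
ℕᵇToReversed-reversedToℕᵇ []          = refl
ℕᵇToReversed-reversedToℕᵇ (false ∷ r) = cong (false ∷_) (ℕᵇToReversed-reversedToℕᵇ r)
ℕᵇToReversed-reversedToℕᵇ (true ∷ r)  = cong (true ∷_) (ℕᵇToReversed-reversedToℕᵇ r)

reversedToℕᵇ-ℕᵇToReversed : ∀ n → reversedToℕᵇ (ℕᵇToReversed n) ≡ n
reversedToℕᵇ-ℕᵇToReversed ℕᵇ.zero = refl
reversedToℕᵇ-ℕᵇToReversed 1+[2 n ] = cong 1+[2_] (reversedToℕᵇ-ℕᵇToReversed n)
reversedToℕᵇ-ℕᵇToReversed 2[1+ n ] = cong 2[1+_] (reversedToℕᵇ-ℕᵇToReversed n)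

strToℕ-reverse : ∀ r → strToℕ (reverse r) ≡ ℕᵇ.toℕ (reversedToℕᵇ r)
strToℕ-reverse [] = refl
strToℕ-reverse (false ∷ r)
  rewrite unfold-reverse false r | strToℕ-∷ʳ (reverse r) false | strToℕ-reverse r
  = trans (+-identityʳ _) (+-comm _ 1)
strToℕ-reverse (true ∷ r)
  rewrite unfold-reverse true r | strToℕ-∷ʳ (reverse r) true | strToℕ-reverse r
  = digit-two (ℕᵇ.toℕ (reversedToℕᵇ r))
  where
  digit-two : ∀ n → 2 * n + 1 + 1 ≡ 2 * suc n
  digit-two = solve-∀

ℕtoStr : ℕ → Str
ℕtoStr n = reverse (ℕᵇToReversed (ℕᵇ.fromℕ n))

strToℕ-ℕtoStr : ∀ n → strToℕ (ℕtoStr n) ≡ n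
strToℕ-ℕtoStr n = begin
  strToℕ (ℕtoStr n)                                   ≡⟨ strToℕ-reverse (ℕᵇToReversed (ℕᵇ.fromℕ n)) ⟩
  ℕᵇ.toℕ (reversedToℕᵇ (ℕᵇToReversed (ℕᵇ.fromℕ n))) ≡⟨ cong ℕᵇ.toℕ (reversedToℕᵇ-ℕᵇToReversed (ℕᵇ.fromℕ n)) ⟩
  ℕᵇ.toℕ (ℕᵇ.fromℕ n)                                ≡⟨ ℕᵇ.toℕ-fromℕ n ⟩
  n                                                   ∎
  where open ≡-Reasoning

ℕtoStr-strToℕ : ∀ x → ℕtoStr (strToℕ x) ≡ x
ℕtoStr-strToℕ x = begin
  ℕtoStr (strToℕ x)                        ≡⟨ cong ℕtoStr (trans (cong strToℕ (sym (reverse-involutive x))) (strToℕ-reverse (reverse x))) ⟩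
  ℕtoStr (ℕᵇ.toℕ (reversedToℕᵇ (reverse x))) ≡⟨ cong (reverse ∘ ℕᵇToReversed) (ℕᵇ.fromℕ-toℕ (reversedToℕᵇ (reverse x))) ⟩
  reverse (ℕᵇToReversed (reversedToℕᵇ (reverse x))) ≡⟨ cong reverse (ℕᵇToReversed-reversedToℕᵇ (reverse x)) ⟩
  reverse (reverse x)                      ≡⟨ reverse-involutive x ⟩
  x                                        ∎
  where open ≡-Reasoning

strToℕ-injective : ∀ {x y} → strToℕ x ≡ strToℕ y → x ≡ y
strToℕ-injective {x} {y} e =
  trans (sym (ℕtoStr-strToℕ x)) (trans (cong ℕtoStr e) (ℕtoStr-strToℕ y))

lexLe⇒value≤ : ∀ z y → length z ≡ length y → lexLe z y → value z ≤ value y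
lexLe⇒value≤ []      []      _ _ = z≤n
lexLe⇒value≤ (_ ∷ z) (_ ∷ y) e (inj₁ (refl , refl)) rewrite value-true∷ y = begin
  value z               ≤⟨ <⇒≤ (value<2^length z) ⟩
  2 ^ length z          ≡⟨ cong (2 ^_) (suc-injective e) ⟩
  2 ^ length y          ≤⟨ m≤m+n _ _ ⟩
  2 ^ length y + value y ∎
  where open ≤-Reasoning
lexLe⇒value≤ (a ∷ z) (_ ∷ y) e (inj₂ (refl , l))
  rewrite value-∷ a z | value-∷ a y | suc-injective e
  = +-monoʳ-≤ (bit a * 2 ^ length y) (lexLe⇒value≤ z y (suc-injective e) l)

value≤⇒lexLe : ∀ z y → length z ≡ length y → value z ≤ value y → lexLe z y
value≤⇒lexLe []          []          _ _  = tt
value≤⇒lexLe (false ∷ z) (false ∷ y) e le = inj₂ (refl , value≤⇒lexLe z y (suc-injective e) le)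
value≤⇒lexLe (false ∷ z) (true ∷ y)  e le = inj₁ (refl , refl)
value≤⇒lexLe (true ∷ z)  (true ∷ y)  e le
  rewrite value-true∷ z | value-true∷ y | suc-injective e
  = inj₂ (refl , value≤⇒lexLe z y (suc-injective e) (+-cancelˡ-≤ (2 ^ length y) _ _ le))
value≤⇒lexLe (true ∷ z)  (false ∷ y) e le rewrite value-true∷ z | suc-injective e =
  ⊥-elim (<⇒≱ (value<2^length y) (≤-trans (m≤m+n _ _) le))

length<⇒strToℕ< : ∀ z y → length z < length y → strToℕ z < strToℕ y
length<⇒strToℕ< z y lt = s≤s⁻¹ (begin-strict
  suc (strToℕ z)               ≡⟨ suc-strToℕ z ⟩
  2 ^ length z + value z       <⟨ +-monoʳ-< (2 ^ length z) (value<2^length z) ⟩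
  2 ^ length z + 2 ^ length z  ≡⟨ cong (2 ^ length z +_) (+-identityʳ _) ⟨
  2 ^ suc (length z)           ≤⟨ ^-monoʳ-≤ 2 lt ⟩
  2 ^ length y                 ≤⟨ m≤m+n _ _ ⟩
  2 ^ length y + value y       ≡⟨ suc-strToℕ y ⟨
  suc (strToℕ y)               ∎)
  where open ≤-Reasoning

≤ll⇒strToℕ≤ : ∀ z y → z ≤ll y → strToℕ z ≤ strToℕ y
≤ll⇒strToℕ≤ z y (inj₁ lt) = <⇒≤ (length<⇒strToℕ< z y lt)
≤ll⇒strToℕ≤ z y (inj₂ (e , l)) = s≤s⁻¹ (begin
  suc (strToℕ z)          ≡⟨ suc-strToℕ z ⟩
  2 ^ length z + value z  ≤⟨ +-monoʳ-≤ (2 ^ length z) (lexLe⇒value≤ z y e l) ⟩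
  2 ^ length z + value y  ≡⟨ cong (λ n → 2 ^ n + value y) e ⟩
  2 ^ length y + value y  ≡⟨ suc-strToℕ y ⟨
  suc (strToℕ y)          ∎)
  where open ≤-Reasoning

strToℕ≤⇒≤ll : ∀ z y → strToℕ z ≤ strToℕ y → z ≤ll y
strToℕ≤⇒≤ll z y le with <-cmp (length z) (length y)
... | tri< lt _ _ = inj₁ lt
... | tri> _ _ gt = ⊥-elim (<⇒≱ (length<⇒strToℕ< y z gt) le)
... | tri≈ _ e _  = inj₂ (e , value≤⇒lexLe z y e (+-cancelˡ-≤ (2 ^ length z) _ _ (begin
  2 ^ length z + value z  ≡⟨ suc-strToℕ z ⟨
  suc (strToℕ z)          ≤⟨ s≤s le ⟩
  suc (strToℕ y)          ≡⟨ suc-strToℕ y ⟩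
  2 ^ length y + value y  ≡⟨ cong (λ n → 2 ^ n + value y) e ⟨
  2 ^ length z + value y  ∎)))
  where open ≤-Reasoning

appendBit-≤ll⇔ : ∀ z x b → (z ∷ʳ b) ≤ll (x ∷ʳ true) ⇔ z ≤ll x
appendBit-≤ll⇔ z x b = mk⇔
  (λ le → strToℕ≤⇒≤ll z x (halve (strToℕ z) (strToℕ x)
    (subst₂ _≤_ (strToℕ-∷ʳ z b) (strToℕ-∷ʳ x true) (≤ll⇒strToℕ≤ (z ∷ʳ b) (x ∷ʳ true) le))))
  (λ le → strToℕ≤⇒≤ll (z ∷ʳ b) (x ∷ʳ true) (subst₂ _≤_ (sym (strToℕ-∷ʳ z b)) (sym (strToℕ-∷ʳ x true))
    (+-mono-≤ (+-monoˡ-≤ 1 (*-monoʳ-≤ 2 (≤ll⇒strToℕ≤ z x le))) (bit≤1 b))))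
  where
  halve : ∀ m n → 2 * m + 1 + bit b ≤ 2 * n + 1 + 1 → m ≤ n
  halve m n le = s≤s⁻¹ (*-cancelˡ-< 2 m (suc n) (begin-strict
    2 * m              <⟨ m<m+n (2 * m) z<s ⟩
    2 * m + 1          ≤⟨ m≤m+n _ (bit b) ⟩
    2 * m + 1 + bit b  ≤⟨ le ⟩
    2 * n + 1 + 1      ≡⟨ double-suc n ⟩
    2 * suc n          ∎))
    where
    open ≤-Reasoning
    double-suc : ∀ n → 2 * n + 1 + 1 ≡ 2 * suc n
    double-suc = solve-∀

RankIs-functional : ∀ {L y m n} → RankIs L y m → RankIs L y n → m ≡ n
RankIs-functional (l₁ , u₁ , l₁≈ , refl) (l₂ , u₂ , l₂≈ , refl) =
  ↭-length (∼bag⇒↭ (unique∧set⇒bag u₁ u₂ (λ {z} →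
    mk⇔ (λ p → from (l₂≈ z) (to (l₁≈ z) p)) (λ p → from (l₁≈ z) (to (l₂≈ z) p)))))

RankIs-⊕ : ∀ A B x {m n} → RankIs A x m → RankIs B x n → RankIs (A ⊕ B) (x ∷ʳ true) (m + n)
RankIs-⊕ A B x (lA , uA , lA≈ , refl) (lB , uB , lB≈ , refl) =
  fromA ++ fromB ,
  Unique.++⁺ (Unique.map⁺ (λ {y} {z} → ∷ʳ-injectiveˡ y z) uA) (Unique.map⁺ (λ {y} {z} → ∷ʳ-injectiveˡ y z) uB) disjoint ,
  (λ w → mk⇔ (sound w) (complete w)) ,
  trans (length-++ fromA) (cong₂ _+_ (length-map _ lA) (length-map _ lB))
  where
  fromA = map (_∷ʳ false) lA
  fromB = map (_∷ʳ true) lB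
  disjoint : ∀ {w} → ¬ (w ∈ fromA × w ∈ fromB)
  disjoint (p , q) with ∈-map⁻ (_∷ʳ false) p | ∈-map⁻ (_∷ʳ true) q
  ... | y , _ , refl | z , _ , e with () ← ∷ʳ-injectiveʳ y z e
  sound : ∀ w → w ∈ fromA ++ fromB → w ≤ll (x ∷ʳ true) × (A ⊕ B) w
  sound w p with ∈-++⁻ fromA p
  ... | inj₁ q with z , z∈ , refl ← ∈-map⁻ (_∷ʳ false) q
    = from (appendBit-≤ll⇔ z x false) (proj₁ (to (lA≈ z) z∈)) , inj₁ (z , refl , proj₂ (to (lA≈ z) z∈))
  ... | inj₂ q with z , z∈ , refl ← ∈-map⁻ (_∷ʳ true) q
    = from (appendBit-≤ll⇔ z x true) (proj₁ (to (lB≈ z) z∈)) , inj₂ (z , refl , proj₂ (to (lB≈ z) z∈))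
  complete : ∀ w → w ≤ll (x ∷ʳ true) × (A ⊕ B) w → w ∈ fromA ++ fromB
  complete w (le , inj₁ (z , refl , z∈A)) =
    ∈-++⁺ˡ (∈-map⁺ (_∷ʳ false) (from (lA≈ z) (to (appendBit-≤ll⇔ z x false) le , z∈A)))
  complete w (le , inj₂ (z , refl , z∈B)) =
    ∈-++⁺ʳ fromA (∈-map⁺ (_∷ʳ true) (from (lB≈ z) (to (appendBit-≤ll⇔ z x true) le , z∈B)))

-- The languages Tagged c

Tagged : (ℕ → Bool) → Lang
Tagged c []      = ⊥
Tagged c (b ∷ y) = y ≢ [] × b ≡ c (length y)

tag : (ℕ → Bool) → Str → Str
tag c y = c (length y) ∷ y

strToℕ≢0 : ∀ {u} → u ≢ [] → strToℕ u ≢ 0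
strToℕ≢0 u≢[] e = u≢[] (strToℕ-injective e)

nonemptyUpTo : ℕ → List Str
nonemptyUpTo = applyUpTo (ℕtoStr ∘ suc)

∈-nonemptyUpTo⁺ : ∀ {N u} → u ≢ [] → strToℕ u ≤ N → u ∈ nonemptyUpTo N
∈-nonemptyUpTo⁺ {N} {u} u≢[] le with strToℕ u in e
... | zero  = ⊥-elim (strToℕ≢0 u≢[] e)
... | suc i = subst (_∈ nonemptyUpTo N) (strToℕ-injective (trans (strToℕ-ℕtoStr (suc i)) (sym e)))
                (∈-applyUpTo⁺ (ℕtoStr ∘ suc) le)

∈-nonemptyUpTo⁻ : ∀ {N u} → u ∈ nonemptyUpTo N → u ≢ [] × strToℕ u ≤ N
∈-nonemptyUpTo⁻ {N} p with i , i<N , refl ← ∈-applyUpTo⁻ (ℕtoStr ∘ suc) p =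
  (λ e → 0≢1+n (trans (cong strToℕ (sym e)) (strToℕ-ℕtoStr (suc i)))) ,
  subst (_≤ N) (sym (strToℕ-ℕtoStr (suc i))) i<N

nonemptyUpTo-unique : ∀ N → Unique (nonemptyUpTo N)
nonemptyUpTo-unique N = Unique.applyUpTo⁺₁ (ℕtoStr ∘ suc) N λ {i} {j} i<j _ e →
  <⇒≢ i<j (suc-injective (trans (sym (strToℕ-ℕtoStr (suc i))) (trans (cong strToℕ e) (strToℕ-ℕtoStr (suc j)))))

RankIs-Tagged : ∀ c w N → (∀ u → u ≢ [] → tag c u ≤ll w ⇔ strToℕ u ≤ N) → RankIs (Tagged c) w N
RankIs-Tagged c w N tag≤w⇔ =
  map (tag c) (nonemptyUpTo N) ,
  Unique.map⁺ ∷-injectiveʳ (nonemptyUpTo-unique N) ,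
  (λ z → mk⇔ (sound z) (complete z)) ,
  trans (length-map (tag c) (nonemptyUpTo N)) (length-applyUpTo _ N)
  where
  sound : ∀ z → z ∈ map (tag c) (nonemptyUpTo N) → z ≤ll w × Tagged c z
  sound z p with u , u∈ , refl ← ∈-map⁻ (tag c) p with u≢[] , u≤N ← ∈-nonemptyUpTo⁻ u∈ =
    from (tag≤w⇔ u u≢[]) u≤N , u≢[] , refl
  complete : ∀ z → z ≤ll w × Tagged c z → z ∈ map (tag c) (nonemptyUpTo N)
  complete (_ ∷ u) (le , u≢[] , refl) = ∈-map⁺ (tag c) (∈-nonemptyUpTo⁺ u≢[] (to (tag≤w⇔ u u≢[]) le))

tag-≤ll⇔ : ∀ c u y → tag c u ≤ll tag c y ⇔ u ≤ll y
tag-≤ll⇔ c u y = mk⇔ untag retag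
  where
  untag : tag c u ≤ll tag c y → u ≤ll y
  untag (inj₁ (s≤s lt))               = inj₁ lt
  untag (inj₂ (e , inj₂ (_ , l)))     = inj₂ (suc-injective e , l)
  untag (inj₂ (e , inj₁ (cu≡0 , cy≡1))) with () ← trans (sym cu≡0) (trans (cong c (suc-injective e)) cy≡1)
  retag : u ≤ll y → tag c u ≤ll tag c y
  retag (inj₁ lt)      = inj₁ (s≤s lt)
  retag (inj₂ (e , l)) = inj₂ (cong suc e , inj₂ (cong c e , l))

RankIs-tag : ∀ c y → RankIs (Tagged c) (tag c y) (strToℕ y)
RankIs-tag c y = RankIs-Tagged c (tag c y) (strToℕ y) λ u _ → mk⇔
  (≤ll⇒strToℕ≤ u y ∘ to (tag-≤ll⇔ c u y))
  (from (tag-≤ll⇔ c u y) ∘ strToℕ≤⇒≤ll u y)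

RankIs-Tagged-false : ∀ c y → c (length y) ≡ false → RankIs (Tagged c) (false ∷ y) (strToℕ y)
RankIs-Tagged-false c y cy≡0 = subst (λ b → RankIs (Tagged c) (b ∷ y) (strToℕ y)) cy≡0 (RankIs-tag c y)

drop1-ranks-Tagged : ∀ c → IsRankingFn (Tagged c) (drop 1)
drop1-ranks-Tagged c (_ ∷ y) (_ , refl) = RankIs-tag c y

replicate-false-lexLe : ∀ u → lexLe (replicate (length u) false) u
replicate-false-lexLe []          = tt
replicate-false-lexLe (false ∷ u) = inj₂ (refl , replicate-false-lexLe u)
replicate-false-lexLe (true ∷ u)  = inj₁ (refl , refl)

replicate-false-≤ll : ∀ n u → n ≤ length u → replicate n false ≤ll u
replicate-false-≤ll n u le with m≤n⇒m<n∨m≡n le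
... | inj₁ lt   = inj₁ (subst (_< length u) (sym (length-replicate n)) lt)
... | inj₂ refl = inj₂ (length-replicate (length u) , replicate-false-lexLe u)

lexLe-∷-false : ∀ {b u v} → lexLe (b ∷ u) (false ∷ v) → b ≡ false
lexLe-∷-false (inj₁ (b≡0 , _)) = b≡0
lexLe-∷-false (inj₂ (b≡0 , _)) = b≡0

pred[n]≢n : ∀ {n} → n ≢ 0 → pred n ≢ n
pred[n]≢n {zero}  n≢0 = ⊥-elim (n≢0 refl)
pred[n]≢n {suc _} _   = 1+n≢n ∘ sym

m≤pred[n]⇒m<n : ∀ {m n} → 0 < m → m ≤ pred n → m < n
m≤pred[n]⇒m<n {n = zero}  0<m m≤0 = ⊥-elim (<⇒≱ 0<m m≤0)
m≤pred[n]⇒m<n {n = suc n} _   m≤n = s≤s m≤n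

-- As c n = true, every tagged string of length n + 1 starts with 1 and lies above 0 0ⁿ.
RankIs-Tagged-replicate : ∀ c n → c n ≡ true →
  RankIs (Tagged c) (false ∷ replicate n false) (pred (strToℕ (replicate n false)))
RankIs-Tagged-replicate c n cn≡1 = RankIs-Tagged c (false ∷ 0ⁿ) (pred (strToℕ 0ⁿ)) λ u u≢[] → mk⇔
  (λ le → <⇒≤pred (below u le))
  (λ le → above u (m≤pred[n]⇒m<n (n≢0⇒n>0 (strToℕ≢0 u≢[])) le))
  where
  0ⁿ = replicate n false
  below : ∀ u → tag c u ≤ll (false ∷ 0ⁿ) → strToℕ u < strToℕ 0ⁿ
  below u (inj₁ (s≤s lt)) = length<⇒strToℕ< u 0ⁿ lt
  below u (inj₂ (e , l)) with () ← trans (sym cn≡1)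
    (trans (cong c (sym (trans (suc-injective e) (length-replicate n)))) (lexLe-∷-false l))
  above : ∀ u → strToℕ u < strToℕ 0ⁿ → tag c u ≤ll (false ∷ 0ⁿ)
  above u lt with length 0ⁿ ≤? length u
  ... | yes 0ⁿ≤u = ⊥-elim (<⇒≱ lt (≤ll⇒strToℕ≤ 0ⁿ u (replicate-false-≤ll n u
                     (subst (_≤ length u) (length-replicate n) 0ⁿ≤u))))
  ... | no  0ⁿ≰u = inj₁ (s≤s (≰⇒> 0ⁿ≰u))

-- Turing machines

Entry : ℕ → ℕ → Set
Entry a b = Maybe (Fin (suc a) × Fin (3 + b) × Move)

Table : ℕ → ℕ → Set
Table a b = Fin (suc a) → Fin (3 + b) → Entry a b

machine : (a b : ℕ) → Fin (suc a) → Table a b → TM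
machine a b s δ = record { nStates = a ; extra = b ; start = s ; δ = δ }

module _ (M : TM) where

  run-halted : ∀ t c → Halted M c → run M t c ≡ c
  run-halted zero    c _ = refl
  run-halted (suc t) c h with step M c
  ... | nothing = refl

  run-step : ∀ t {c c′} → step M c ≡ just c′ → run M (suc t) c ≡ run M t c′
  run-step t {c} e with step M c
  run-step t refl | just _ = refl

  run-+ : ∀ t d c → run M (t + d) c ≡ run M d (run M t c)
  run-+ zero    d c = refl
  run-+ (suc t) d c with step M c in e
  ... | nothing = sym (run-halted d c e)
  ... | just c′ = run-+ t d c′

  run-stable : ∀ {t T} c → t ≤ T → Halted M (run M t c) → run M T c ≡ run M t c
  run-stable {t} {T} c t≤T h = begin
    run M T c                 ≡⟨ cong (λ n → run M n c) (m+[n∸m]≡n t≤T) ⟨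
    run M (t + (T ∸ t)) c     ≡⟨ run-+ t (T ∸ t) c ⟩
    run M (T ∸ t) (run M t c) ≡⟨ run-halted (T ∸ t) (run M t c) h ⟩
    run M t c                 ∎
    where open ≡-Reasoning

  output-at-bound : ∀ {T f} → ComputesWithin M T f →
    ∀ x → output M (run M (T (length x)) (initCfg M x)) ≡ f x
  output-at-bound comp x with t , t≤T , halted , out ← comp x =
    trans (cong (output M) (run-stable (initCfg M x) t≤T halted)) out

  transition : Config M → Entry (TM.nStates M) (TM.extra M) → Maybe (Config M)
  transition c nothing            = nothing
  transition c (just (q , s , m)) =
    just (move M m (Config.left c) s (Config.right c) (record c { state = q }))

  step≡transition : ∀ c → step M c ≡ transition c (TM.δ M (Config.state c) (Config.head c))
  step≡transition c with TM.δ M (Config.state c) (Config.head c)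
  ... | nothing = refl
  ... | just _  = refl

  decode-map-enc : ∀ x → decode M (map (enc M) x) ≡ x
  decode-map-enc []          = refl
  decode-map-enc (false ∷ x) = cong (false ∷_) (decode-map-enc x)
  decode-map-enc (true ∷ x)  = cong (true ∷_) (decode-map-enc x)

dropHead : TM
dropHead = machine 1 0 Fin.zero δ
  where
  δ : Table 1 0
  δ Fin.zero Fin.zero    = nothing
  δ Fin.zero (Fin.suc _) = just (Fin.suc Fin.zero , Fin.zero , R)
  δ (Fin.suc _) _        = nothing

drop1-PolyTime : PolyTime (drop 1)
drop1-PolyTime = dropHead , 1 , 0 , computes
  where
  computes : ComputesWithin dropHead (λ n → 1 * n ^ 0 + 1) (drop 1)
  computes []              = 0 , z≤n , refl , refl
  computes (false ∷ [])    = 1 , s≤s z≤n , refl , refl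
  computes (true ∷ [])     = 1 , s≤s z≤n , refl , refl
  computes (false ∷ b ∷ x) = 1 , s≤s z≤n , refl , decode-map-enc dropHead (b ∷ x)
  computes (true ∷ b ∷ x)  = 1 , s≤s z≤n , refl , decode-map-enc dropHead (b ∷ x)

module _ {a b} {s₁ s₂ : Fin (suc a)} {δ₁ δ₂ : Table a b}
         (s₁≡s₂ : s₁ ≡ s₂) (δ₁≗δ₂ : ∀ q σ → δ₁ q σ ≡ δ₂ q σ) where

  -- Config M₁ and Config M₂ are distinct types although their fields agree.
  private
    M₁ M₂ : TM
    M₁ = machine a b s₁ δ₁
    M₂ = machine a b s₂ δ₂

    relabel : Config M₁ → Config M₂
    relabel c = cfg (Config.state c) (Config.left c) (Config.head c) (Config.right c)

    transition-relabel : ∀ c t → transition M₂ (relabel c) t ≡ Maybe.map relabel (transition M₁ c t)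
    transition-relabel _               nothing                = refl
    transition-relabel (cfg _ []      _ _) (just (_ , _ , L)) = refl
    transition-relabel (cfg _ (_ ∷ _) _ _) (just (_ , _ , L)) = refl
    transition-relabel (cfg _ _ _ [])      (just (_ , _ , R)) = refl
    transition-relabel (cfg _ _ _ (_ ∷ _)) (just (_ , _ , R)) = refl
    transition-relabel (cfg _ _ _ _)       (just (_ , _ , S)) = refl

    step-relabel : ∀ c → step M₂ (relabel c) ≡ Maybe.map relabel (step M₁ c)
    step-relabel c@(cfg q l h r) = begin
      step M₂ (relabel c)                              ≡⟨ step≡transition M₂ (relabel c) ⟩
      transition M₂ (relabel c) (δ₂ q h)               ≡⟨ cong (transition M₂ (relabel c)) (δ₁≗δ₂ q h) ⟨
      transition M₂ (relabel c) (δ₁ q h)               ≡⟨ transition-relabel c (δ₁ q h) ⟩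
      Maybe.map relabel (transition M₁ c (δ₁ q h))     ≡⟨ cong (Maybe.map relabel) (step≡transition M₁ c) ⟨
      Maybe.map relabel (step M₁ c)                    ∎
      where open ≡-Reasoning

    run-relabel : ∀ t c → run M₂ t (relabel c) ≡ relabel (run M₁ t c)
    run-relabel zero    c = refl
    run-relabel (suc t) c = after-step (step M₁ c) refl
      where
      after-step : ∀ m → step M₁ c ≡ m → run M₂ (suc t) (relabel c) ≡ relabel (run M₁ (suc t) c)
      after-step nothing  e = trans (run-halted M₂ (suc t) (relabel c) (trans (step-relabel c) (cong (Maybe.map relabel) e)))
                                    (cong relabel (sym (run-halted M₁ (suc t) c e)))
      after-step (just c′) e = begin
        run M₂ (suc t) (relabel c) ≡⟨ run-step M₂ t (trans (step-relabel c) (cong (Maybe.map relabel) e)) ⟩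
        run M₂ t (relabel c′)      ≡⟨ run-relabel t c′ ⟩
        relabel (run M₁ t c′)      ≡⟨ cong relabel (run-step M₁ t e) ⟨
        relabel (run M₁ (suc t) c) ∎
        where open ≡-Reasoning

    enc-relabel : ∀ d → enc M₂ d ≡ enc M₁ d
    enc-relabel false = refl
    enc-relabel true  = refl

    initCfg-relabel : ∀ x → initCfg M₂ x ≡ relabel (initCfg M₁ x)
    initCfg-relabel []          = cong (λ s → cfg s [] (blank M₂) []) (sym s₁≡s₂)
    initCfg-relabel (false ∷ x) = cong₂ (λ s r → cfg s [] (enc M₂ false) r) (sym s₁≡s₂) (map-cong enc-relabel x)
    initCfg-relabel (true ∷ x)  = cong₂ (λ s r → cfg s [] (enc M₂ true) r) (sym s₁≡s₂) (map-cong enc-relabel x)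

    decode-relabel : ∀ l → decode M₂ l ≡ decode M₁ l
    decode-relabel []      = refl
    decode-relabel (s ∷ l) with Fin.toℕ s
    ... | 0                 = refl
    ... | 1                 = cong (false ∷_) (decode-relabel l)
    ... | 2                 = cong (true ∷_) (decode-relabel l)
    ... | suc (suc (suc _)) = refl

  output-at-bound-pointwise : ∀ {T f} → ComputesWithin M₁ T f →
    ∀ x → output M₂ (run M₂ (T (length x)) (initCfg M₂ x)) ≡ f x
  output-at-bound-pointwise {T} {f} comp x = begin
    output M₂ (run M₂ (T (length x)) (initCfg M₂ x))            ≡⟨ cong (output M₂ ∘ run M₂ (T (length x))) (initCfg-relabel x) ⟩
    output M₂ (run M₂ (T (length x)) (relabel (initCfg M₁ x)))  ≡⟨ cong (output M₂) (run-relabel (T (length x)) (initCfg M₁ x)) ⟩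
    output M₂ (relabel (run M₁ (T (length x)) (initCfg M₁ x)))  ≡⟨ decode-relabel _ ⟩
    output M₁ (run M₁ (T (length x)) (initCfg M₁ x))            ≡⟨ output-at-bound M₁ {T} comp x ⟩
    f x                                                          ∎
    where open ≡-Reasoning

-- Enumerating clock-bounded machines

toℕ-mod : ∀ {n} (i : Fin (suc n)) → Fin.toℕ i mod suc n ≡ i
toℕ-mod i = toℕ-injectiveᶠ (trans (toℕ-fromℕ< _) (m<n⇒m%n≡m (toℕ<n i)))

moveToℕ : Move → ℕ
moveToℕ L = 0
moveToℕ R = 1
moveToℕ S = 2

ℕToMove : ℕ → Move
ℕToMove 0 = L
ℕToMove 1 = R
ℕToMove _ = S

ℕToMove-moveToℕ : ∀ m → ℕToMove (moveToℕ m) ≡ m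
ℕToMove-moveToℕ L = refl
ℕToMove-moveToℕ R = refl
ℕToMove-moveToℕ S = refl

encodeEntry : ∀ {a b} → Entry a b → ℕ × ℕ × ℕ × ℕ
encodeEntry nothing            = 0 , 0 , 0 , 0
encodeEntry (just (q , s , m)) = 1 , Fin.toℕ q , Fin.toℕ s , moveToℕ m

decodeEntry : ∀ a b → ℕ × ℕ × ℕ × ℕ → Entry a b
decodeEntry a b (zero  , _)         = nothing
decodeEntry a b (suc _ , q , s , m) = just (q mod suc a , s mod (3 + b) , ℕToMove m)

decodeEntry-encodeEntry : ∀ {a b} (e : Entry a b) → decodeEntry a b (encodeEntry e) ≡ e
decodeEntry-encodeEntry nothing = refl
decodeEntry-encodeEntry (just (q , s , m)) rewrite toℕ-mod q | toℕ-mod s | ℕToMove-moveToℕ m = refl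

-- A table is listed as consecutive blocks  q σ t q′ s′ m  (six numbers per entry).
lookupTable : ∀ a b → ℕ → ℕ → List ℕ → Entry a b
lookupTable a b q σ (q₀ ∷ σ₀ ∷ t ∷ q′ ∷ s′ ∷ m ∷ rest) with q ≟ q₀ | σ ≟ σ₀
... | yes _ | yes _ = decodeEntry a b (t , q′ , s′ , m)
... | _     | _     = lookupTable a b q σ rest
lookupTable a b q σ _ = nothing

listTable : ∀ {a b} → Table a b → List (Fin (suc a) × Fin (3 + b)) → List ℕ
listTable δ []             = []
listTable δ ((q , σ) ∷ ks) =
  let (t , q′ , s′ , m) = encodeEntry (δ q σ) in
  Fin.toℕ q ∷ Fin.toℕ σ ∷ t ∷ q′ ∷ s′ ∷ m ∷ listTable δ ks

lookupTable-listTable : ∀ {a b} (δ : Table a b) {q σ} ks → (q , σ) ∈ ks →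
  lookupTable a b (Fin.toℕ q) (Fin.toℕ σ) (listTable δ ks) ≡ δ q σ
lookupTable-listTable {a} {b} δ {q} {σ} ((q₀ , σ₀) ∷ ks) q,σ∈ with Fin.toℕ q ≟ Fin.toℕ q₀ | Fin.toℕ σ ≟ Fin.toℕ σ₀ | q,σ∈
... | yes q≡ | yes σ≡ | _ rewrite toℕ-injectiveᶠ q≡ | toℕ-injectiveᶠ σ≡ = decodeEntry-encodeEntry (δ q₀ σ₀)
... | no q≢  | _      | here refl = ⊥-elim (q≢ refl)
... | yes _  | no σ≢  | here refl = ⊥-elim (σ≢ refl)
... | no _   | _      | there q,σ∈ks = lookupTable-listTable δ ks q,σ∈ks
... | yes _  | no _   | there q,σ∈ks = lookupTable-listTable δ ks q,σ∈ks

allKeys : ∀ a b → List (Fin (suc a) × Fin (3 + b))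
allKeys a b = cartesianProduct (allFin (suc a)) (allFin (3 + b))

normalise : TM → TM
normalise M = machine a b (Fin.toℕ (TM.start M) mod suc a)
  (λ q σ → lookupTable a b (Fin.toℕ q) (Fin.toℕ σ) (listTable (TM.δ M) (allKeys a b)))
  where
  a = TM.nStates M
  b = TM.extra M

output-at-bound-normalise : ∀ M {T f} → ComputesWithin M T f →
  ∀ x → output (normalise M) (run (normalise M) (T (length x)) (initCfg (normalise M) x)) ≡ f x
output-at-bound-normalise M {T} {f} = output-at-bound-pointwise (sym (toℕ-mod (TM.start M)))
  (λ q σ → sym (lookupTable-listTable (TM.δ M) (allKeys _ _) (∈-cartesianProduct⁺ (∈-allFin q) (∈-allFin σ))))
  {T} {f}

listToStr : List ℕ → Str
listToStr []       = []
listToStr (n ∷ ns) = replicate n true ++ false ∷ listToStr ns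

readUnary : ℕ → Str → List ℕ
readUnary acc []          = []
readUnary acc (true ∷ x)  = readUnary (suc acc) x
readUnary acc (false ∷ x) = acc ∷ readUnary 0 x

readUnary-replicate : ∀ n acc x → readUnary acc (replicate n true ++ false ∷ x) ≡ n + acc ∷ readUnary 0 x
readUnary-replicate zero    acc x = refl
readUnary-replicate (suc n) acc x = trans (readUnary-replicate n (suc acc) x) (cong (_∷ readUnary 0 x) (+-suc n acc))

readUnary-listToStr : ∀ ns → readUnary 0 (listToStr ns) ≡ ns
readUnary-listToStr []       = refl
readUnary-listToStr (n ∷ ns) = trans (readUnary-replicate n 0 (listToStr ns)) (cong₂ _∷_ (+-identityʳ n) (readUnary-listToStr ns))

Clocked : Set
Clocked = TM × ℕ × ℕ

encodeClocked : TM → ℕ → ℕ → List ℕ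
encodeClocked M c k =
  c ∷ k ∷ TM.nStates M ∷ TM.extra M ∷ Fin.toℕ (TM.start M) ∷ listTable (TM.δ M) (allKeys _ _)

decodeClocked : List ℕ → Clocked
decodeClocked (c ∷ k ∷ a ∷ b ∷ s ∷ table) =
  machine a b (s mod suc a) (λ q σ → lookupTable a b (Fin.toℕ q) (Fin.toℕ σ) table) , c , k
decodeClocked _ = dropHead , 0 , 0

enumerate : ℕ → Clocked
enumerate = decodeClocked ∘ readUnary 0 ∘ ℕtoStr

enumerate-complete : ∀ M c k → Σ ℕ λ j → enumerate j ≡ (normalise M , c , k)
enumerate-complete M c k = strToℕ (listToStr code) ,
  cong decodeClocked (trans (cong (readUnary 0) (ℕtoStr-strToℕ (listToStr code))) (readUnary-listToStr code))
  where code = encodeClocked M c k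

clockedOutput : Clocked → Str → Str
clockedOutput (M , c , k) x = output M (run M (c * length x ^ k + c) (initCfg M x))

-- Diagonalisation

Tagged-PRankable : ∀ c → PRankable (Tagged c)
Tagged-PRankable c = drop 1 , drop1-PolyTime , drop1-ranks-Tagged c

zeros : ℕ → Str
zeros j = replicate (suc j) false

witness : ℕ → Str
witness j = (false ∷ zeros j) ∷ʳ true

guess : ℕ → ℕ
guess j = strToℕ (clockedOutput (enumerate j) (witness j))

diagonal : ℕ → Bool
diagonal zero    = false
diagonal (suc j) = does (guess j ≟ strToℕ (zeros j) + strToℕ (zeros j))

A B : Lang
A = Tagged diagonal
B = Tagged (λ _ → false)

witness-rank-true : ∀ j → diagonal (suc j) ≡ true →
  RankIs (A ⊕ B) (witness j) (pred (strToℕ (zeros j)) + strToℕ (zeros j))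
witness-rank-true j dj≡1 = RankIs-⊕ A B (false ∷ zeros j)
  (RankIs-Tagged-replicate diagonal (suc j) dj≡1) (RankIs-tag _ (zeros j))

witness-rank-false : ∀ j → diagonal (suc j) ≡ false →
  RankIs (A ⊕ B) (witness j) (strToℕ (zeros j) + strToℕ (zeros j))
witness-rank-false j dj≡0 = RankIs-⊕ A B (false ∷ zeros j)
  (RankIs-Tagged-false diagonal (zeros j) (trans (cong diagonal (length-replicate (suc j))) dj≡0))
  (RankIs-tag _ (zeros j))

guess-wrong : ∀ j → ¬ RankIs (A ⊕ B) (witness j) (guess j)
guess-wrong j rank with guess j ≟ strToℕ (zeros j) + strToℕ (zeros j) in e
... | yes guess≡ = pred[n]≢n (strToℕ≢0 {zeros j} λ ()) (+-cancelʳ-≡ (strToℕ (zeros j)) _ _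
                     (trans (sym (RankIs-functional rank (witness-rank-true j (cong does e)))) guess≡))
... | no guess≢  = guess≢ (RankIs-functional rank (witness-rank-false j (cong does e)))

⊕-not-PRankable : ¬ PRankable (A ⊕ B)
⊕-not-PRankable (f , (M , c , k , computes) , ranks) with j , enum≡ ← enumerate-complete M c k =
  guess-wrong j (subst (RankIs (A ⊕ B) (witness j)) f-guesses (ranks (witness j) witness∈B))
  where
  witness∈B : (A ⊕ B) (witness j)
  witness∈B = inj₂ (false ∷ zeros j , refl , (λ ()) , refl)
  f-guesses : strToℕ (f (witness j)) ≡ guess j
  f-guesses = cong strToℕ (trans (sym (output-at-bound-normalise M {λ n → c * n ^ k + c} computes (witness j)))
                                 (cong (λ e → clockedOutput e (witness j)) (sym enum≡)))

theorem27 : Σ Lang λ A → Σ Lang λ B →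
    PRankable A × PRankable B × ¬ PRankable (A ⊕ B)
theorem27 = A , B , Tagged-PRankable diagonal , Tagged-PRankable (λ _ → false) , ⊕-not-PRankable
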